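{- Let $f:\mathbb{F}_2^{2m}\to\mathbb{F}_2$ be a bent function and let $h$ be a bent function that is extended affine equivalent to $f$. Then there exists a bent function $g$ that is extended Cayley equivalent to $h$ and extended translation equivalent to $f$.
   Context: $\langle x,y\rangle=\sum_i x_iy_i$ over $\mathbb{F}_2$. $f$ is bent iff $|\sum_y(-1)^{f(y)+\langle x,y\rangle}|=2^m$ for all $x$. Functions $f,h:\mathbb{F}_2^n\to\mathbb{F}_2$ are extended affine equivalent iff $h(x)=f(Ax+b)+\langle c,x\rangle+\delta$ for some $A\in GL(n,2)$, $b,c\in\mathbb{F}_2^n$, $\delta\in\mathbb{F}_2$; extended translation equivalent iff $h(x)=f(x+b)+\langle c,x\rangle+\delta$ for some $b,c\in\mathbb{F}_2^n$, $\delta\in\mathbb{F}_2$. For $u$ with $u(0)=0$, $\mathrm{Cay}(u)$ is the simple graph on $\mathbb{F}_2^n$ with $i\sim j$ iff $u(i+j)=1$. Functions $f,g$ are extended Cayley equivalent iff $\mathrm{Cay}(f+f(0))$ and $\mathrm{Cay}(g+g(0))$ are isomorphic. -}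

module Defs where

open import Data.Bool using (Bool; true; false; _xor_; _∧_)
open import Data.Nat using (ℕ; zero; suc; _^_; _+_)
open import Data.Vec using (Vec; []; _∷_; zipWith; replicate; map; foldr)
open import Data.List using (List; []; _∷_; _++_) renaming (map to lmap)
open import Data.Integer using (ℤ; +_; -_; ∣_∣) renaming (_+_ to _+ℤ_)
open import Data.Product using (Σ; _×_; _,_; ∃)
open import Relation.Binary.PropositionalEquality using (_≡_)
open import Function.Bundles using (_⤖_; Bijection)
open import Function.Base using (_∘_)

-- F_2 is Bool with xor as addition, ∧ as multiplication
F₂ : Set
F₂ = Bool

V : ℕ → Set
V n = Vec Bool n

_⊕_ : ∀ {n} → V n → V n → V n
_⊕_ = zipWith _xor_

⟨_,_⟩ : ∀ {n} → V n → V n → F₂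
⟨ [] , [] ⟩ = false
⟨ x ∷ xs , y ∷ ys ⟩ = (x ∧ y) xor ⟨ xs , ys ⟩

𝟎 : ∀ {n} → V n
𝟎 = replicate _ false

allV : (n : ℕ) → List (V n)
allV zero = [] ∷ []
allV (suc n) = lmap (false ∷_) (allV n) ++ lmap (true ∷_) (allV n)

sgn : Bool → ℤ
sgn false = + 1
sgn true  = - (+ 1)

sumℤ : List ℤ → ℤ
sumℤ [] = + 0
sumℤ (a ∷ as) = a +ℤ sumℤ as

walsh : ∀ {n} → (V n → F₂) → V n → ℤ
walsh {n} f x = sumℤ (lmap (λ y → sgn (f y xor ⟨ x , y ⟩)) (allV n))

IsBent : (m : ℕ) → (V (m + m) → F₂) → Set
IsBent m f = ∀ x → ∣ walsh f x ∣ ≡ 2 ^ m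

-- matrices over F_2 (list of rows) acting on column vectors
Mat : ℕ → Set
Mat n = Vec (V n) n

_·_ : ∀ {n} → Mat n → V n → V n
A · x = map (λ row → ⟨ row , x ⟩) A

IsInvertible : ∀ {n} → Mat n → Set
IsInvertible {n} A = Σ (Mat n) λ B → (∀ x → B · (A · x) ≡ x) × (∀ x → A · (B · x) ≡ x)

EAEquiv : ∀ {n} → (V n → F₂) → (V n → F₂) → Set
EAEquiv {n} f h = Σ (Mat n) λ A → IsInvertible A × Σ (V n) λ b → Σ (V n) λ c → Σ F₂ λ δ →
  ∀ x → h x ≡ (f ((A · x) ⊕ b) xor ⟨ c , x ⟩) xor δ

ETEquiv : ∀ {n} → (V n → F₂) → (V n → F₂) → Set
ETEquiv {n} f h = Σ (V n) λ b → Σ (V n) λ c → Σ F₂ λ δ →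
  ∀ x → h x ≡ (f (x ⊕ b) xor ⟨ c , x ⟩) xor δ

CayAdj : ∀ {n} → (V n → F₂) → V n → V n → Set
CayAdj u i j = u (i ⊕ j) ≡ true

CayIso : ∀ {n} → (V n → F₂) → (V n → F₂) → Set
CayIso {n} u v = Σ (V n ⤖ V n) λ π →
  ∀ i j → (CayAdj u i j → CayAdj v (Bijection.to π i) (Bijection.to π j))
        × (CayAdj v (Bijection.to π i) (Bijection.to π j) → CayAdj u i j)

norm : ∀ {n} → (V n → F₂) → V n → F₂
norm f x = f x xor f 𝟎

ECEquiv : ∀ {n} → (V n → F₂) → (V n → F₂) → Set
ECEquiv f g = CayIso (norm f) (norm g)

-- Write h x = f (A x + b) + ⟨c, x⟩ + δ and let B = A⁻¹. Then g y = f (y + b) + ⟨Bᵀ c, y⟩ + δ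
-- satisfies g (A x) = h x, so the linear automorphism x ↦ A x is an isomorphism
-- Cay(h + h(0)) ≅ Cay(g + g(0)), while g is extended translation equivalent to f by construction.
-- Translations, added linear functions and added constants only permute the Walsh spectrum up to
-- sign, so g is bent because f is.
module Submission where

open import Defs
open import Data.Nat using (ℕ; _+_; _^_; suc)
open import Data.Product using (Σ; _×_; _,_)
open import Data.Bool using (true; false; _xor_; _∧_)
open import Data.Bool.Properties using (xor-assoc; xor-comm; xor-same; xor-identityʳ; ∧-zeroʳ; ∧-assoc; ∧-distribˡ-xor; ∧-distribʳ-xor; xor-∧-commutativeRing)
open import Data.Vec using (Vec; []; _∷_; map)
open import Data.List using (List) renaming (map to lmap; _∷_ to _∷ₗ_; [] to []ₗ; _++_ to _++ₗ_)
open import Data.List.Properties using (map-++; map-∘; map-cong)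
open import Data.Integer using (ℤ; ∣_∣) renaming (_+_ to _+ℤ_; _*_ to _*ℤ_)
open import Data.Integer.Properties using (+-identityˡ; +-assoc; +-comm; *-zeroʳ; *-distribˡ-+; *-comm; abs-*)
open import Data.Nat.Properties using () renaming (*-identityˡ to ℕ-*-identityˡ)
open import Algebra.Bundles using (CommutativeRing)
open import Algebra.Properties.CommutativeSemigroup (CommutativeRing.+-commutativeSemigroup xor-∧-commutativeRing) using (interchange)
open import Relation.Binary.PropositionalEquality using (_≡_; refl; sym; trans; cong; cong₂; module ≡-Reasoning)
open import Function.Bundles using (mk↔ₛ′)
open import Function.Properties.Inverse using (↔⇒⤖)

open ≡-Reasoning

private
  variable
    n k : ℕ

⟨⟩-distribʳ-⊕ : (u v w : V n) → ⟨ u , v ⊕ w ⟩ ≡ ⟨ u , v ⟩ xor ⟨ u , w ⟩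
⟨⟩-distribʳ-⊕ [] [] [] = refl
⟨⟩-distribʳ-⊕ (a ∷ u) (b ∷ v) (c ∷ w) = begin
  (a ∧ (b xor c)) xor ⟨ u , v ⊕ w ⟩
    ≡⟨ cong₂ _xor_ (∧-distribˡ-xor a b c) (⟨⟩-distribʳ-⊕ u v w) ⟩
  ((a ∧ b) xor (a ∧ c)) xor (⟨ u , v ⟩ xor ⟨ u , w ⟩)
    ≡⟨ interchange (a ∧ b) (a ∧ c) ⟨ u , v ⟩ ⟨ u , w ⟩ ⟩
  ((a ∧ b) xor ⟨ u , v ⟩) xor ((a ∧ c) xor ⟨ u , w ⟩) ∎

⟨⟩-distribˡ-⊕ : (u v w : V n) → ⟨ u ⊕ v , w ⟩ ≡ ⟨ u , w ⟩ xor ⟨ v , w ⟩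
⟨⟩-distribˡ-⊕ [] [] [] = refl
⟨⟩-distribˡ-⊕ (a ∷ u) (b ∷ v) (c ∷ w) = begin
  ((a xor b) ∧ c) xor ⟨ u ⊕ v , w ⟩
    ≡⟨ cong₂ _xor_ (∧-distribʳ-xor c a b) (⟨⟩-distribˡ-⊕ u v w) ⟩
  ((a ∧ c) xor (b ∧ c)) xor (⟨ u , w ⟩ xor ⟨ v , w ⟩)
    ≡⟨ interchange (a ∧ c) (b ∧ c) ⟨ u , w ⟩ ⟨ v , w ⟩ ⟩
  ((a ∧ c) xor ⟨ u , w ⟩) xor ((b ∧ c) xor ⟨ v , w ⟩) ∎

⟨⟩-zeroʳ : (u : V n) → ⟨ u , 𝟎 ⟩ ≡ false
⟨⟩-zeroʳ [] = refl
⟨⟩-zeroʳ (a ∷ u) = cong₂ _xor_ (∧-zeroʳ a) (⟨⟩-zeroʳ u)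

⟨⟩-zeroˡ : (u : V n) → ⟨ 𝟎 , u ⟩ ≡ false
⟨⟩-zeroˡ [] = refl
⟨⟩-zeroˡ (a ∷ u) = ⟨⟩-zeroˡ u

⟨⟩-scaleˡ : (a : F₂) (u v : V n) → ⟨ map (a ∧_) u , v ⟩ ≡ a ∧ ⟨ u , v ⟩
⟨⟩-scaleˡ a [] [] = sym (∧-zeroʳ a)
⟨⟩-scaleˡ a (b ∷ u) (c ∷ v) = begin
  ((a ∧ b) ∧ c) xor ⟨ map (a ∧_) u , v ⟩ ≡⟨ cong₂ _xor_ (∧-assoc a b c) (⟨⟩-scaleˡ a u v) ⟩
  (a ∧ (b ∧ c)) xor (a ∧ ⟨ u , v ⟩)     ≡⟨ sym (∧-distribˡ-xor a (b ∧ c) ⟨ u , v ⟩) ⟩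
  a ∧ ((b ∧ c) xor ⟨ u , v ⟩)           ∎

⊕-cancelʳ : (x b : V n) → (x ⊕ b) ⊕ b ≡ x
⊕-cancelʳ [] [] = refl
⊕-cancelʳ (x ∷ xs) (b ∷ bs) = cong₂ _∷_ (xor-cancelʳ x b) (⊕-cancelʳ xs bs)
  where
  xor-cancelʳ : ∀ x b → (x xor b) xor b ≡ x
  xor-cancelʳ x b = trans (xor-assoc x b b) (trans (cong (x xor_) (xor-same b)) (xor-identityʳ x))

·-distrib-⊕ : (A : Mat n) (x y : V n) → A · (x ⊕ y) ≡ (A · x) ⊕ (A · y)
·-distrib-⊕ {n} A x y = rows A
  where
  rows : (R : Vec (V n) k) →
         map (λ r → ⟨ r , x ⊕ y ⟩) R ≡ map (λ r → ⟨ r , x ⟩) R ⊕ map (λ r → ⟨ r , y ⟩) R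
  rows [] = refl
  rows (r ∷ R) = cong₂ _∷_ (⟨⟩-distribʳ-⊕ r x y) (rows R)

·-zero : (A : Mat n) → A · 𝟎 ≡ 𝟎
·-zero {n} A = rows A
  where
  rows : (R : Vec (V n) k) → map (λ r → ⟨ r , 𝟎 ⟩) R ≡ 𝟎
  rows [] = refl
  rows (r ∷ R) = cong₂ _∷_ (⟨⟩-zeroʳ r) (rows R)

-- R ᵀ· c is the transpose of R applied to c, i.e. the combination of the rows of R with coefficients c.
_ᵀ·_ : Vec (V n) k → V k → V n
[] ᵀ· [] = 𝟎
(r ∷ R) ᵀ· (a ∷ c) = map (a ∧_) r ⊕ (R ᵀ· c)

⟨⟩-transpose : (A : Mat n) (c y : V n) → ⟨ c , A · y ⟩ ≡ ⟨ A ᵀ· c , y ⟩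
⟨⟩-transpose {n} A c y = rows A c
  where
  rows : (R : Vec (V n) k) (c : V k) → ⟨ c , map (λ r → ⟨ r , y ⟩) R ⟩ ≡ ⟨ R ᵀ· c , y ⟩
  rows [] [] = sym (⟨⟩-zeroˡ y)
  rows (r ∷ R) (a ∷ c) = begin
    (a ∧ ⟨ r , y ⟩) xor ⟨ c , map (λ r → ⟨ r , y ⟩) R ⟩
      ≡⟨ cong₂ _xor_ (sym (⟨⟩-scaleˡ a r y)) (rows R c) ⟩
    ⟨ map (a ∧_) r , y ⟩ xor ⟨ R ᵀ· c , y ⟩
      ≡⟨ sym (⟨⟩-distribˡ-⊕ (map (a ∧_) r) (R ᵀ· c) y) ⟩
    ⟨ map (a ∧_) r ⊕ (R ᵀ· c) , y ⟩ ∎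

sumV : (n : ℕ) → (V n → ℤ) → ℤ
sumV n F = sumℤ (lmap F (allV n))

sumℤ-++ : (xs ys : List ℤ) → sumℤ (xs ++ₗ ys) ≡ sumℤ xs +ℤ sumℤ ys
sumℤ-++ []ₗ ys = sym (+-identityˡ _)
sumℤ-++ (x ∷ₗ xs) ys = trans (cong (x +ℤ_) (sumℤ-++ xs ys)) (sym (+-assoc x (sumℤ xs) (sumℤ ys)))

sumℤ-*ˡ : {A : Set} (s : ℤ) (F : A → ℤ) (xs : List A) →
          sumℤ (lmap (λ z → s *ℤ F z) xs) ≡ s *ℤ sumℤ (lmap F xs)
sumℤ-*ˡ s F []ₗ = sym (*-zeroʳ s)
sumℤ-*ˡ s F (x ∷ₗ xs) = trans (cong (s *ℤ F x +ℤ_) (sumℤ-*ˡ s F xs)) (sym (*-distribˡ-+ s (F x) _))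

sumV-suc : (F : V (suc n) → ℤ) → sumV (suc n) F ≡ sumV n (λ y → F (false ∷ y)) +ℤ sumV n (λ y → F (true ∷ y))
sumV-suc {n} F
  rewrite map-++ F (lmap (false ∷_) (allV n)) (lmap (true ∷_) (allV n))
        | sumℤ-++ (lmap F (lmap (false ∷_) (allV n))) (lmap F (lmap (true ∷_) (allV n)))
        | sym (map-∘ {g = F} {f = false ∷_} (allV n))
        | sym (map-∘ {g = F} {f = true ∷_} (allV n)) = refl

sumV-cong : {F G : V n → ℤ} → (∀ y → F y ≡ G y) → sumV n F ≡ sumV n G
sumV-cong {n} eq = cong sumℤ (map-cong eq (allV n))

sumV-translate : (b : V n) (F : V n → ℤ) → sumV n (λ y → F (y ⊕ b)) ≡ sumV n F
sumV-translate [] F = refl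
sumV-translate {suc n} (false ∷ b) F
  rewrite sumV-suc (λ y → F (y ⊕ (false ∷ b))) | sumV-suc F
        | sumV-translate b (λ y → F (false ∷ y)) | sumV-translate b (λ y → F (true ∷ y)) = refl
sumV-translate {suc n} (true ∷ b) F
  rewrite sumV-suc (λ y → F (y ⊕ (true ∷ b))) | sumV-suc F
        | sumV-translate b (λ y → F (true ∷ y)) | sumV-translate b (λ y → F (false ∷ y))
  = +-comm (sumV n (λ y → F (true ∷ y))) (sumV n (λ y → F (false ∷ y)))

sgn-xor : (a b : F₂) → sgn (a xor b) ≡ sgn a *ℤ sgn b
sgn-xor false false = refl
sgn-xor false true  = refl
sgn-xor true  false = refl
sgn-xor true  true  = refl

∣sgn*∣ : (e : F₂) (w : ℤ) → ∣ sgn e *ℤ w ∣ ≡ ∣ w ∣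
∣sgn*∣ false w = trans (abs-* (sgn false) w) (ℕ-*-identityˡ ∣ w ∣)
∣sgn*∣ true  w = trans (abs-* (sgn true) w) (ℕ-*-identityˡ ∣ w ∣)

walsh-cong : {f g : V n → F₂} → (∀ y → f y ≡ g y) → (x : V n) → walsh f x ≡ walsh g x
walsh-cong eq x = sumV-cong (λ y → cong (λ t → sgn (t xor ⟨ x , y ⟩)) (eq y))

walsh-xor-const : (f : V n → F₂) (δ : F₂) (x : V n) → walsh (λ y → f y xor δ) x ≡ sgn δ *ℤ walsh f x
walsh-xor-const {n} f δ x = trans (sumV-cong term) (sumℤ-*ˡ (sgn δ) (λ y → sgn (f y xor ⟨ x , y ⟩)) (allV n))
  where
  term : ∀ y → sgn ((f y xor δ) xor ⟨ x , y ⟩) ≡ sgn δ *ℤ sgn (f y xor ⟨ x , y ⟩)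
  term y = begin
    sgn ((f y xor δ) xor ⟨ x , y ⟩) ≡⟨ cong sgn (xor-assoc (f y) δ ⟨ x , y ⟩) ⟩
    sgn (f y xor (δ xor ⟨ x , y ⟩)) ≡⟨ cong (λ t → sgn (f y xor t)) (xor-comm δ ⟨ x , y ⟩) ⟩
    sgn (f y xor (⟨ x , y ⟩ xor δ)) ≡⟨ sym (cong sgn (xor-assoc (f y) ⟨ x , y ⟩ δ)) ⟩
    sgn ((f y xor ⟨ x , y ⟩) xor δ) ≡⟨ sgn-xor (f y xor ⟨ x , y ⟩) δ ⟩
    sgn (f y xor ⟨ x , y ⟩) *ℤ sgn δ ≡⟨ *-comm (sgn (f y xor ⟨ x , y ⟩)) (sgn δ) ⟩
    sgn δ *ℤ sgn (f y xor ⟨ x , y ⟩) ∎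

walsh-xor-linear : (f : V n → F₂) (c x : V n) → walsh (λ y → f y xor ⟨ c , y ⟩) x ≡ walsh f (c ⊕ x)
walsh-xor-linear f c x = sumV-cong λ y → cong sgn (begin
  (f y xor ⟨ c , y ⟩) xor ⟨ x , y ⟩ ≡⟨ xor-assoc (f y) ⟨ c , y ⟩ ⟨ x , y ⟩ ⟩
  f y xor (⟨ c , y ⟩ xor ⟨ x , y ⟩) ≡⟨ sym (cong (f y xor_) (⟨⟩-distribˡ-⊕ c x y)) ⟩
  f y xor ⟨ c ⊕ x , y ⟩             ∎)

walsh-translate : (f : V n → F₂) (b x : V n) → walsh (λ y → f (y ⊕ b)) x ≡ sgn ⟨ x , b ⟩ *ℤ walsh f x
walsh-translate {n} f b x = begin
  sumV n (λ y → sgn (f (y ⊕ b) xor ⟨ x , y ⟩))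
    ≡⟨ sumV-cong (λ y → cong (λ t → sgn (f (y ⊕ b) xor ⟨ x , t ⟩)) (sym (⊕-cancelʳ y b))) ⟩
  sumV n (λ y → shifted (y ⊕ b))
    ≡⟨ sumV-translate b shifted ⟩
  sumV n shifted
    ≡⟨ sumV-cong (λ z → cong sgn (exponent z)) ⟩
  walsh (λ z → f z xor ⟨ x , b ⟩) x
    ≡⟨ walsh-xor-const f ⟨ x , b ⟩ x ⟩
  sgn ⟨ x , b ⟩ *ℤ walsh f x ∎
  where
  shifted : V n → ℤ
  shifted z = sgn (f z xor ⟨ x , z ⊕ b ⟩)

  exponent : ∀ z → f z xor ⟨ x , z ⊕ b ⟩ ≡ (f z xor ⟨ x , b ⟩) xor ⟨ x , z ⟩
  exponent z = begin
    f z xor ⟨ x , z ⊕ b ⟩             ≡⟨ cong (f z xor_) (⟨⟩-distribʳ-⊕ x z b) ⟩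
    f z xor (⟨ x , z ⟩ xor ⟨ x , b ⟩) ≡⟨ cong (f z xor_) (xor-comm ⟨ x , z ⟩ ⟨ x , b ⟩) ⟩
    f z xor (⟨ x , b ⟩ xor ⟨ x , z ⟩) ≡⟨ sym (xor-assoc (f z) ⟨ x , b ⟩ ⟨ x , z ⟩) ⟩
    (f z xor ⟨ x , b ⟩) xor ⟨ x , z ⟩ ∎

ETEquiv-preserves-bent : (m : ℕ) {f g : V (m + m) → F₂} → ETEquiv f g → IsBent m f → IsBent m g
ETEquiv-preserves-bent m {f} {g} (b , c , δ , g≡) bent-f x = begin
  ∣ walsh g x ∣                                 ≡⟨ cong ∣_∣ (walsh-cong g≡ x) ⟩
  ∣ walsh (λ y → f+c y xor δ) x ∣               ≡⟨ cong ∣_∣ (walsh-xor-const f+c δ x) ⟩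
  ∣ sgn δ *ℤ walsh f+c x ∣                      ≡⟨ ∣sgn*∣ δ (walsh f+c x) ⟩
  ∣ walsh f+c x ∣                               ≡⟨ cong ∣_∣ (walsh-xor-linear (λ y → f (y ⊕ b)) c x) ⟩
  ∣ walsh (λ y → f (y ⊕ b)) (c ⊕ x) ∣           ≡⟨ cong ∣_∣ (walsh-translate f b (c ⊕ x)) ⟩
  ∣ sgn ⟨ c ⊕ x , b ⟩ *ℤ walsh f (c ⊕ x) ∣      ≡⟨ ∣sgn*∣ ⟨ c ⊕ x , b ⟩ (walsh f (c ⊕ x)) ⟩
  ∣ walsh f (c ⊕ x) ∣                           ≡⟨ bent-f (c ⊕ x) ⟩
  2 ^ m                                         ∎
  where
  f+c : V (m + m) → F₂
  f+c y = f (y ⊕ b) xor ⟨ c , y ⟩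

ECEquiv-linear : (A : Mat n) → IsInvertible A → {g h : V n → F₂} →
                 (∀ x → g (A · x) ≡ h x) → ECEquiv h g
ECEquiv-linear A (B , BA , AB) {g} {h} g∘A≡h = ↔⇒⤖ (mk↔ₛ′ (A ·_) (B ·_) AB BA) , λ i j →
  trans (adjacency i j) , trans (sym (adjacency i j))
  where
  adjacency : ∀ i j → norm g ((A · i) ⊕ (A · j)) ≡ norm h (i ⊕ j)
  adjacency i j = cong₂ _xor_
    (trans (cong g (sym (·-distrib-⊕ A i j))) (g∘A≡h (i ⊕ j)))
    (trans (cong g (sym (·-zero A))) (g∘A≡h 𝟎))

mainTheorem5 : (m : ℕ) (f h : V (m + m) → F₂) → IsBent m f → IsBent m h → EAEquiv f h →
    Σ (V (m + m) → F₂) λ g → IsBent m g × ECEquiv h g × ETEquiv f g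
mainTheorem5 m f h bent-f _ (A , A-inv@(B , BA , _) , b , c , δ , h≡) =
  g , ETEquiv-preserves-bent m {f} f~g bent-f , ECEquiv-linear A A-inv {g} g∘A≡h , f~g
  where
  g : V (m + m) → F₂
  g y = (f (y ⊕ b) xor ⟨ B ᵀ· c , y ⟩) xor δ

  f~g : ETEquiv f g
  f~g = b , B ᵀ· c , δ , λ _ → refl

  g∘A≡h : ∀ x → g (A · x) ≡ h x
  g∘A≡h x = begin
    (f ((A · x) ⊕ b) xor ⟨ B ᵀ· c , A · x ⟩) xor δ ≡⟨ cong (λ t → (f ((A · x) ⊕ b) xor t) xor δ) linear-part ⟩
    (f ((A · x) ⊕ b) xor ⟨ c , x ⟩) xor δ         ≡⟨ sym (h≡ x) ⟩
    h x                                           ∎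
    where
    linear-part : ⟨ B ᵀ· c , A · x ⟩ ≡ ⟨ c , x ⟩
    linear-part = trans (sym (⟨⟩-transpose B c (A · x))) (cong ⟨ c ,_⟩ (BA x))
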